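{- Let $\boldsymbol\xi$ be an integral slope datum, $K=\xi_\Omega+\xi_{\bar\Omega}$, and let $\boldsymbol\lambda,\boldsymbol\mu$ be $\ell$-multi-partitions with $\boldsymbol\mu=\boldsymbol\lambda\sqcup\{b\}$ for a single box $b$ of color $\bar\imath$. Then $\Psi(\boldsymbol\mu)=A^{ -1}_{\mathbf c;\bar\imath,h^{\boldsymbol\xi}(b)}\Psi(\boldsymbol\lambda)$.
   Context: Fix $n\ge2$, $\ell\ge1$, $p\colon\{1,\dots,\ell\}\to\mathbb Z/n$. Multi-partitions $\boldsymbol\lambda=(\lambda(1),\dots,\lambda(\ell))$ have boxes $(k;i,j)$ ($i,j\ge1$, $j\le\lambda(k)_i$), color $\bar c(k;i,j)=p(k)-i+j\bmod n$. $A(\boldsymbol\lambda)$ (resp. $R(\boldsymbol\lambda)$) is the set of boxes that can be added to (resp. removed from) some $\lambda(k)$ leaving a partition. A slope datum $\boldsymbol\xi=(\xi_\Omega,\xi_{\bar\Omega},\xi_1,\dots,\xi_\ell)$ is integral if its entries are positive integers; $h^{\boldsymbol\xi}(k;i,j)=\xi_k+\xi_\Omega i+\xi_{\bar\Omega}j$. Monomials in variables $Y_{\bar\jmath,m}$ ($\bar\jmath\in\mathbb Z/n$, $m\in\mathbb Z$); with $c_{\bar\jmath,\bar\jmath+1}=\xi_{\bar\Omega}$ and $c_{\bar\jmath+1,\bar\jmath}=\xi_\Omega$ for all $\bar\jmath$, $A_{\mathbf c;\bar\jmath,m}=Y_{\bar\jmath,m}Y_{\bar\jmath,m+K}Y^{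 -1}_{\bar\jmath+1,m+\xi_{\bar\Omega}}Y^{ -1}_{\bar\jmath-1,m+\xi_\Omega}$. For a multi-partition, $\Psi(\boldsymbol\lambda)=\prod_{a\in A(\boldsymbol\lambda)}Y_{\bar c(a),h^{\boldsymbol\xi}(a)}\prod_{r\in R(\boldsymbol\lambda)}Y^{ -1}_{\bar c(r),h^{\boldsymbol\xi}(r)+K}$. -}

module Defs where

open import Data.Nat as ℕ using (ℕ; zero; suc; NonZero; _≤_; _<_)
open import Data.Nat.Properties using (_≟_; _≤?_; _<?_)
open import Data.Integer as ℤ using (ℤ; +_; _%ℕ_)
open import Data.Integer.DivMod using (n%ℕd<d)
import Data.Integer.Properties as ℤP
open import Data.Fin as Fin using (Fin; toℕ; fromℕ<)
import Data.Fin.Properties as FinP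
open import Data.List using (List; []; _∷_; length; map; concatMap; filter; foldr; upTo; allFin)
open import Data.List.Relation.Unary.All using (All)
open import Data.List.Relation.Unary.Linked using (Linked)
open import Data.Product using (_×_; _,_; Σ)
open import Data.Product.Relation.Binary.Pointwise.NonDependent using ()
open import Data.Sum using (_⊎_)
open import Relation.Nullary using (¬_; Dec; yes; no)
open import Relation.Nullary.Decidable using (_×-dec_; _⊎-dec_; ¬?)
open import Relation.Binary.PropositionalEquality using (_≡_)
open import Function.Bundles using (_⇔_)

record Partition : Set where
  constructor mkPartition
  field
    parts    : List ℕ
    decr     : Linked ℕ._≥_ parts
    positive : All (0 <_) parts
open Partition public

-- row length λ_i, rows indexed from 1 (λ_i = 0 for i > r; row 0 unused)
rowL : List ℕ → ℕ → ℕ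
rowL []       _             = 0
rowL (x ∷ xs) zero          = 0
rowL (x ∷ xs) (suc zero)    = x
rowL (x ∷ xs) (suc (suc i)) = rowL xs (suc i)

row : Partition → ℕ → ℕ
row λ' i = rowL (parts λ') i

_∈ᵖ_ : ℕ × ℕ → Partition → Set
(i , j) ∈ᵖ λ' = (1 ≤ i) × (1 ≤ j) × (j ≤ row λ' i)

_∈ᵖ?_ : (b : ℕ × ℕ) → (λ' : Partition) → Dec (b ∈ᵖ λ')
(i , j) ∈ᵖ? λ' = (1 ≤? i) ×-dec ((1 ≤? j) ×-dec (j ≤? row λ' i))

IsAddable : Partition → ℕ × ℕ → Set
IsAddable λ' (i , j) =
  (1 ≤ i) × (1 ≤ j) × ¬ ((i , j) ∈ᵖ λ')
  × ((i ≡ 1) ⊎ ((ℕ.pred i , j) ∈ᵖ λ'))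
  × ((j ≡ 1) ⊎ ((i , ℕ.pred j) ∈ᵖ λ'))

isAddable? : (λ' : Partition) → (b : ℕ × ℕ) → Dec (IsAddable λ' b)
isAddable? λ' (i , j) =
  (1 ≤? i) ×-dec ((1 ≤? j) ×-dec (¬? ((i , j) ∈ᵖ? λ')
  ×-dec (((i ≟ 1) ⊎-dec ((ℕ.pred i , j) ∈ᵖ? λ'))
  ×-dec ((j ≟ 1) ⊎-dec ((i , ℕ.pred j) ∈ᵖ? λ')))))

IsRemovable : Partition → ℕ × ℕ → Set
IsRemovable λ' (i , j) =
  ((i , j) ∈ᵖ λ') × ¬ ((suc i , j) ∈ᵖ λ') × ¬ ((i , suc j) ∈ᵖ λ')

isRemovable? : (λ' : Partition) → (b : ℕ × ℕ) → Dec (IsRemovable λ' b)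
isRemovable? λ' (i , j) =
  ((i , j) ∈ᵖ? λ') ×-dec (¬? ((suc i , j) ∈ᵖ? λ') ×-dec ¬? ((i , suc j) ∈ᵖ? λ'))

-- A finite rectangle of candidate boxes containing every addable and
-- every removable box: rows 1 … r+1, columns 1 … λ_1 + 1.
candidates : Partition → List (ℕ × ℕ)
candidates λ' =
  concatMap (λ i → map (λ j → (i , j)) (map suc (upTo (suc (row λ' 1)))))
            (map suc (upTo (suc (length (parts λ')))))

-- A(λ') and R(λ') for a single partition, as duplicate-free lists
addableBoxes : Partition → List (ℕ × ℕ)
addableBoxes λ' = filter (isAddable? λ') (candidates λ')

removableBoxes : Partition → List (ℕ × ℕ)
removableBoxes λ' = filter (isRemovable? λ') (candidates λ')

MultiPartition : ℕ → Set
MultiPartition ℓ = Fin ℓ → Partition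

Box : ℕ → Set
Box ℓ = Fin ℓ × ℕ × ℕ

_∈ᵐ_ : ∀ {ℓ} → Box ℓ → MultiPartition ℓ → Set
(k , i , j) ∈ᵐ λ' = (i , j) ∈ᵖ λ' k

IsAddBox : ∀ {ℓ} → MultiPartition ℓ → MultiPartition ℓ → Box ℓ → Set
IsAddBox {ℓ} μ λ' b =
  ¬ (b ∈ᵐ λ') × ((c : Box ℓ) → (c ∈ᵐ μ) ⇔ ((c ∈ᵐ λ') ⊎ (c ≡ b)))

record SlopeDatum (ℓ : ℕ) : Set where
  constructor mkSlope
  field
    ξΩ  : ℕ
    ξΩ̄  : ℕ
    ξ   : Fin ℓ → ℕ
open SlopeDatum public

Integral : ∀ {ℓ} → SlopeDatum ℓ → Set
Integral {ℓ} s = (0 < ξΩ s) × (0 < ξΩ̄ s) × ((k : Fin ℓ) → 0 < ξ s k)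

Kof : ∀ {ℓ} → SlopeDatum ℓ → ℕ
Kof s = ξΩ s ℕ.+ ξΩ̄ s

h : ∀ {ℓ} → SlopeDatum ℓ → Box ℓ → ℤ
h s (k , i , j) = + (ξ s k ℕ.+ ξΩ s ℕ.* i ℕ.+ ξΩ̄ s ℕ.* j)

module _ (n : ℕ) .{{_ : NonZero n}} where

  res : ℤ → Fin n
  res z = fromℕ< (n%ℕd<d z n)

  colour : ∀ {ℓ} → (Fin ℓ → Fin n) → Box ℓ → Fin n
  colour p (k , i , j) = res ((+ toℕ (p k) ℤ.- + i) ℤ.+ + j)

  sucᶻ predᶻ : Fin n → Fin n
  sucᶻ a  = res (+ toℕ a ℤ.+ ℤ.1ℤ)
  predᶻ a = res (+ toℕ a ℤ.- ℤ.1ℤ)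

  -- Laurent monomials in Y_{j̄,m} (j̄ ∈ Z/n, m ∈ ℤ), represented by their
  -- exponent functions; multiplication = addition of exponents.

  Monomial : Set
  Monomial = Fin n → ℤ → ℤ

  one : Monomial
  one _ _ = ℤ.0ℤ

  Y : Fin n → ℤ → Monomial
  Y a m a' m' with a' FinP.≟ a | m' ℤP.≟ m
  ... | yes _ | yes _ = ℤ.1ℤ
  ... | _     | _     = ℤ.0ℤ

  infixl 7 _·_
  _·_ : Monomial → Monomial → Monomial
  (f · g) a m = f a m ℤ.+ g a m

  inv : Monomial → Monomial
  inv f a m = ℤ.- f a m

  infix 4 _≈_
  _≈_ : Monomial → Monomial → Set
  f ≈ g = ∀ a m → f a m ≡ g a m

  prodL : ∀ {A : Set} → (A → Monomial) → List A → Monomial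
  prodL f = foldr (λ x acc → f x · acc) one

  Amon : ∀ {ℓ} → SlopeDatum ℓ → Fin n → ℤ → Monomial
  Amon s a m =
    Y a m · Y a (m ℤ.+ + Kof s)
      · inv (Y (sucᶻ a) (m ℤ.+ + ξΩ̄ s))
      · inv (Y (predᶻ a) (m ℤ.+ + ξΩ s))

  Ψ : ∀ {ℓ} → (Fin ℓ → Fin n) → SlopeDatum ℓ → MultiPartition ℓ → Monomial
  Ψ {ℓ} p s λ' =
    prodL (λ k →
        prodL (λ { (i , j) → Y (colour p (k , i , j)) (h s (k , i , j)) })
              (addableBoxes (λ' k))
      · prodL (λ { (i , j) → inv (Y (colour p (k , i , j))
                                      (h s (k , i , j) ℤ.+ + Kof s)) })
              (removableBoxes (λ' k)))
      (allFin ℓ)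

-- Monomials are compared exponent by exponent, so at a fixed variable Y_{a,m} both sides are
-- integers, and Ψ becomes a sum over components of indicator-weighted sums over a common
-- rectangle of cells.  Adding the box b to one component changes addability and removability
-- only at b and its four neighbours: b stops being addable and becomes removable, the cell
-- right of b becomes addable exactly when the cell above b stops being removable, and the
-- cell below b becomes addable exactly when the cell left of b stops being removable.  The
-- cell above b and the cell right of b are diagonal neighbours (same colour, heights differing
-- by K), so each such pair contributes the single factor Y_{ī+1,h(b)+ξ_Ω̄}, resp. Y_{ī-1,h(b)+ξ_Ω};
-- together with Y⁻¹_{ī,h(b)} Y⁻¹_{ī,h(b)+K} from b itself this is A⁻¹_{ī,h(b)}.
module Submission where

open import Defs
open import Data.Bool using (true; false; if_then_else_)
open import Data.Nat as ℕ using (ℕ; zero; suc; NonZero; z≤n; s≤s; _≤_; _<_)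
import Data.Nat.Properties as ℕP
import Data.Nat.Tactic.RingSolver as ℕSolver
open import Data.Integer using (ℤ; +_; -[1+_]; 0ℤ; 1ℤ; _+_; _-_; -_; _*_; _%ℕ_; _/ℕ_)
import Data.Integer.Properties as ℤP
open import Data.Integer.DivMod using (n%ℕd<d; a≡a%ℕn+[a/ℕn]*n)
open import Data.Integer.Tactic.RingSolver using (solve-∀)
open import Data.Fin as Fin using (Fin; toℕ)
import Data.Fin.Properties as FinP
open import Data.List using (List; []; _∷_; length; _++_; map; concat; concatMap; filter; applyUpTo; upTo; allFin; tabulate)
open import Data.List.Relation.Unary.All as All using (All; []; _∷_)
open import Data.List.Relation.Unary.AllPairs using (AllPairs; []; _∷_)
open import Data.List.Relation.Unary.Linked using (Linked; _∷_)
open import Data.Product using (_×_; _,_; proj₁; proj₂)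
open import Data.Product.Properties using (≡-dec)
open import Data.Sum as Sum using (_⊎_; inj₁; inj₂)
open import Data.Empty using (⊥-elim)
open import Function using (_∘_)
open import Function.Bundles using (_⇔_; Equivalence; mk⇔)
import Function.Properties.Equivalence as ⇔
open import Relation.Nullary using (¬_; Dec; yes; no; does)
open import Relation.Nullary.Decidable using (dec-true; dec-false; does-⇔; _×-dec_)
open import Relation.Unary using (Pred; Decidable)
open import Relation.Binary.Definitions using (DecidableEquality)
open import Relation.Binary.PropositionalEquality

private variable
  A B : Set

∑ : List A → (A → ℤ) → ℤ
∑ []       f = 0ℤ
∑ (x ∷ xs) f = f x + ∑ xs f

∑-cong : ∀ (xs : List A) {f g : A → ℤ} → (∀ x → f x ≡ g x) → ∑ xs f ≡ ∑ xs g
∑-cong []       f≗g = refl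
∑-cong (x ∷ xs) f≗g = cong₂ _+_ (f≗g x) (∑-cong xs f≗g)

∑-cong-All : ∀ {xs : List A} {f g : A → ℤ} → All (λ x → f x ≡ g x) xs → ∑ xs f ≡ ∑ xs g
∑-cong-All []       = refl
∑-cong-All (e ∷ es) = cong₂ _+_ e (∑-cong-All es)

∑-zero : ∀ (xs : List A) {f : A → ℤ} → (∀ x → f x ≡ 0ℤ) → ∑ xs f ≡ 0ℤ
∑-zero []       f≗0 = refl
∑-zero (x ∷ xs) f≗0 = cong₂ _+_ (f≗0 x) (∑-zero xs f≗0)

∑-+ : ∀ (xs : List A) (f g : A → ℤ) → ∑ xs (λ x → f x + g x) ≡ ∑ xs f + ∑ xs g
∑-+ []       f g = refl
∑-+ (x ∷ xs) f g = trans (cong (_+_ (f x + g x)) (∑-+ xs f g)) (interchange (f x) (g x) _ _)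
  where
  interchange : ∀ a b c d → (a + b) + (c + d) ≡ (a + c) + (b + d)
  interchange = solve-∀

∑-++ : ∀ (xs ys : List A) (f : A → ℤ) → ∑ (xs ++ ys) f ≡ ∑ xs f + ∑ ys f
∑-++ []       ys f = sym (ℤP.+-identityˡ _)
∑-++ (x ∷ xs) ys f = trans (cong (_+_ (f x)) (∑-++ xs ys f)) (sym (ℤP.+-assoc (f x) _ _))

∑-map : (g : A → B) (xs : List A) (f : B → ℤ) → ∑ (map g xs) f ≡ ∑ xs (f ∘ g)
∑-map g []       f = refl
∑-map g (x ∷ xs) f = cong (_+_ (f (g x))) (∑-map g xs f)

∑-concatMap : (g : A → List B) (xs : List A) (f : B → ℤ) →
              ∑ (concatMap g xs) f ≡ ∑ xs (λ x → ∑ (g x) f)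
∑-concatMap g []       f = refl
∑-concatMap g (x ∷ xs) f =
  trans (∑-++ (g x) (concat (map g xs)) f) (cong (_+_ (∑ (g x) f)) (∑-concatMap g xs f))

∑-comm : (xs : List A) (ys : List B) (f : A → B → ℤ) →
         ∑ xs (λ x → ∑ ys (f x)) ≡ ∑ ys (λ y → ∑ xs (λ x → f x y))
∑-comm []       ys f = sym (∑-zero ys (λ _ → refl))
∑-comm (x ∷ xs) ys f =
  trans (cong (_+_ (∑ ys (f x))) (∑-comm xs ys f)) (sym (∑-+ ys (f x) (λ y → ∑ xs (λ x′ → f x′ y))))

∑-tabulate : ∀ {ℓ} (f : Fin ℓ → A) (g : A → ℤ) → ∑ (tabulate f) g ≡ ∑ (allFin ℓ) (g ∘ f)
∑-tabulate {ℓ = zero}  f g = refl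
∑-tabulate {ℓ = suc ℓ} f g =
  cong (_+_ (g (f Fin.zero))) (trans (∑-tabulate (f ∘ Fin.suc) g) (sym (∑-tabulate Fin.suc (g ∘ f))))

∑-allFin-suc : ∀ {ℓ} (G : Fin (suc ℓ) → ℤ) → ∑ (allFin (suc ℓ)) G ≡ G Fin.zero + ∑ (allFin ℓ) (G ∘ Fin.suc)
∑-allFin-suc G = cong (_+_ (G Fin.zero)) (∑-tabulate Fin.suc G)

∑-allFin-update : ∀ {ℓ} (G G′ : Fin ℓ → ℤ) k₀ D → (∀ k → k ≢ k₀ → G′ k ≡ G k) → G′ k₀ ≡ D + G k₀ →
                  ∑ (allFin ℓ) G′ ≡ D + ∑ (allFin ℓ) G
∑-allFin-update {suc ℓ} G G′ Fin.zero D others here = begin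
  ∑ (allFin (suc ℓ)) G′                     ≡⟨ ∑-allFin-suc G′ ⟩
  G′ Fin.zero + ∑ (allFin ℓ) (G′ ∘ Fin.suc) ≡⟨ cong₂ _+_ here (∑-cong (allFin ℓ) (λ k → others (Fin.suc k) λ ())) ⟩
  (D + G Fin.zero) + ∑ (allFin ℓ) (G ∘ Fin.suc) ≡⟨ ℤP.+-assoc D _ _ ⟩
  D + (G Fin.zero + ∑ (allFin ℓ) (G ∘ Fin.suc)) ≡⟨ cong (_+_ D) (sym (∑-allFin-suc G)) ⟩
  D + ∑ (allFin (suc ℓ)) G                  ∎
  where open ≡-Reasoning
∑-allFin-update {suc ℓ} G G′ (Fin.suc k₀) D others here = begin
  ∑ (allFin (suc ℓ)) G′                     ≡⟨ ∑-allFin-suc G′ ⟩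
  G′ Fin.zero + ∑ (allFin ℓ) (G′ ∘ Fin.suc) ≡⟨ cong₂ _+_ (others Fin.zero λ ()) rest ⟩
  G Fin.zero + (D + ∑ (allFin ℓ) (G ∘ Fin.suc)) ≡⟨ left-comm (G Fin.zero) D _ ⟩
  D + (G Fin.zero + ∑ (allFin ℓ) (G ∘ Fin.suc)) ≡⟨ cong (_+_ D) (sym (∑-allFin-suc G)) ⟩
  D + ∑ (allFin (suc ℓ)) G                  ∎
  where
  open ≡-Reasoning
  rest : ∑ (allFin ℓ) (G′ ∘ Fin.suc) ≡ D + ∑ (allFin ℓ) (G ∘ Fin.suc)
  rest = ∑-allFin-update (G ∘ Fin.suc) (G′ ∘ Fin.suc) k₀ D (λ k k≢k₀ → others (Fin.suc k) (k≢k₀ ∘ FinP.suc-injective)) here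
  left-comm : ∀ x y z → x + (y + z) ≡ y + (x + z)
  left-comm = solve-∀

when : Dec A → ℤ → ℤ
when a? v = if does a? then v else 0ℤ

when-yes : (a? : Dec A) {v : ℤ} → A → when a? v ≡ v
when-yes a? {v} a = cong (if_then v else 0ℤ) (dec-true a? a)

when-no : (a? : Dec A) {v : ℤ} → ¬ A → when a? v ≡ 0ℤ
when-no a? {v} ¬a = cong (if_then v else 0ℤ) (dec-false a? ¬a)

when-⇔ : A ⇔ B → (a? : Dec A) (b? : Dec B) {v : ℤ} → when a? v ≡ when b? v
when-⇔ A⇔B a? b? {v} = cong (if_then v else 0ℤ) (does-⇔ A⇔B a? b?)

when-zero : (a? : Dec A) → when a? 0ℤ ≡ 0ℤ
when-zero (yes _) = refl
when-zero (no _)  = refl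

when-neg : (a? : Dec A) (v : ℤ) → when a? (- v) ≡ - when a? v
when-neg (yes _) v = refl
when-neg (no _)  v = refl

when-exclusive : (a? : Dec A) (b? : Dec B) {v : ℤ} → A ⊎ B → ¬ (A × B) → when a? v + when b? v ≡ v
when-exclusive (yes a) (yes b) _        ¬ab = ⊥-elim (¬ab (a , b))
when-exclusive (yes _) (no _)  _        _   = ℤP.+-identityʳ _
when-exclusive (no _)  (yes _) _        _   = ℤP.+-identityˡ _
when-exclusive (no ¬a) (no ¬b) (inj₁ a) _   = ⊥-elim (¬a a)
when-exclusive (no ¬a) (no ¬b) (inj₂ b) _   = ⊥-elim (¬b b)

∑-filter : {P : Pred A _} (P? : Decidable P) (xs : List A) (f : A → ℤ) →
           ∑ (filter P? xs) f ≡ ∑ xs (λ x → when (P? x) (f x))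
∑-filter P? []       f = refl
∑-filter P? (x ∷ xs) f with does (P? x)
... | true  = cong (_+_ (f x)) (∑-filter P? xs f)
... | false = trans (∑-filter P? xs f) (sym (ℤP.+-identityˡ _))

module _ (_≟_ : DecidableEquality A) where

  pointwise-difference : ∀ {S : List A} → AllPairs _≢_ S → (w w′ : A → ℤ) (x : A) →
                         (All (x ≢_) S → w′ x ≡ w x) →
                         w′ x ≡ w x + ∑ S (λ c → when (x ≟ c) (w′ c - w c))
  pointwise-difference []                    w w′ x agree = trans (agree []) (sym (ℤP.+-identityʳ _))
  pointwise-difference {c ∷ S} (c∉S ∷ distinct) w w′ x agree with x ≟ c
  ... | yes refl = begin
    w′ c                              ≡⟨ add-difference (w′ c) (w c) ⟩
    w c + ((w′ c - w c) + 0ℤ)         ≡⟨ cong (λ z → w c + ((w′ c - w c) + z)) (sym rest≡0) ⟩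
    w c + ((w′ c - w c) + ∑ S _)      ∎
    where
    open ≡-Reasoning
    add-difference : ∀ a b → a ≡ b + ((a - b) + 0ℤ)
    add-difference = solve-∀
    rest≡0 : ∑ S (λ c′ → when (c ≟ c′) (w′ c′ - w c′)) ≡ 0ℤ
    rest≡0 = trans (∑-cong-All (All.map (λ c≢c′ → when-no (c ≟ _) c≢c′) c∉S))
                   (∑-zero S (λ _ → refl))
  ... | no x≢c = trans (pointwise-difference distinct w w′ x (λ x∉S → agree (x≢c ∷ x∉S)))
                       (cong (_+_ (w x)) (sym (ℤP.+-identityˡ _)))

∑-applyUpTo-vanishing : ∀ (f : ℕ → A) N (g : A → ℤ) → (∀ k → g (f k) ≡ 0ℤ) → ∑ (applyUpTo f N) g ≡ 0ℤ
∑-applyUpTo-vanishing f zero    g vanish = refl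
∑-applyUpTo-vanishing f (suc N) g vanish =
  cong₂ _+_ (vanish 0) (∑-applyUpTo-vanishing (f ∘ suc) N g (vanish ∘ suc))

∑-applyUpTo-extend : ∀ (f : ℕ → A) {N M} (g : A → ℤ) → N ≤ M → (∀ k → N ≤ k → g (f k) ≡ 0ℤ) →
                     ∑ (applyUpTo f M) g ≡ ∑ (applyUpTo f N) g
∑-applyUpTo-extend f {M = M} g z≤n vanish = ∑-applyUpTo-vanishing f M g (λ k → vanish k z≤n)
∑-applyUpTo-extend f g (s≤s N≤M) vanish =
  cong (_+_ (g (f 0))) (∑-applyUpTo-extend (f ∘ suc) g N≤M (λ k N≤k → vanish (suc k) (s≤s N≤k)))

∑-applyUpTo-single : ∀ (f : ℕ → A) {N} (g : A → ℤ) {t} → t < N → (∀ k → k ≢ t → g (f k) ≡ 0ℤ) →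
                     ∑ (applyUpTo f N) g ≡ g (f t)
∑-applyUpTo-single f {suc N} g {zero} _ vanish =
  trans (cong (_+_ (g (f 0))) (∑-applyUpTo-vanishing (f ∘ suc) N g (λ k → vanish (suc k) λ ())))
        (ℤP.+-identityʳ _)
∑-applyUpTo-single f {suc N} g {suc t} (s≤s t<N) vanish =
  trans (cong₂ _+_ (vanish 0 λ ()) (∑-applyUpTo-single (f ∘ suc) g t<N (λ k k≢t → vanish (suc k) (k≢t ∘ ℕP.suc-injective))))
        (ℤP.+-identityˡ _)

Cell : Set
Cell = ℕ × ℕ

_≟ᶜ_ : DecidableEquality Cell
_≟ᶜ_ = ≡-dec ℕ._≟_ ℕ._≟_

InGrid : ℕ → ℕ → Cell → Set
InGrid R C (i , j) = (1 ≤ i × i ≤ R) × (1 ≤ j × j ≤ C)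

InGrid-mono : ∀ {R C R′ C′} → R ≤ R′ → C ≤ C′ → ∀ x → InGrid R C x → InGrid R′ C′ x
InGrid-mono R≤R′ C≤C′ (i , j) ((1≤i , i≤R) , (1≤j , j≤C)) =
  (1≤i , ℕP.≤-trans i≤R R≤R′) , (1≤j , ℕP.≤-trans j≤C C≤C′)

-- candidates P is, by definition, grid (suc (length (parts P))) (suc (row P 1)).
grid : ℕ → ℕ → List Cell
grid R C = concatMap (λ i → map (λ j → (i , j)) (map suc (upTo C))) (map suc (upTo R))

∑-grid : ∀ R C (v : Cell → ℤ) → ∑ (grid R C) v ≡ ∑ (upTo R) (λ i → ∑ (upTo C) (λ j → v (suc i , suc j)))
∑-grid R C v = begin
  ∑ (grid R C) v                                            ≡⟨ ∑-concatMap cellsOfRow (map suc (upTo R)) v ⟩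
  ∑ (map suc (upTo R)) (λ i → ∑ (cellsOfRow i) v)           ≡⟨ ∑-map suc (upTo R) _ ⟩
  ∑ (upTo R) (λ i → ∑ (cellsOfRow (suc i)) v)               ≡⟨ ∑-cong (upTo R) rowSum ⟩
  ∑ (upTo R) (λ i → ∑ (upTo C) (λ j → v (suc i , suc j)))   ∎
  where
  open ≡-Reasoning
  cellsOfRow : ℕ → List Cell
  cellsOfRow i = map (λ j → (i , j)) (map suc (upTo C))
  rowSum : ∀ i → ∑ (cellsOfRow (suc i)) v ≡ ∑ (upTo C) (λ j → v (suc i , suc j))
  rowSum i = trans (∑-map (λ j → (suc i , j)) (map suc (upTo C)) v) (∑-map suc (upTo C) _)

SupportedIn : ℕ → ℕ → (Cell → ℤ) → Set
SupportedIn R C v = ∀ x → ¬ InGrid R C x → v x ≡ 0ℤ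

SupportedIn-mono : ∀ {R C R′ C′} (v : Cell → ℤ) → R ≤ R′ → C ≤ C′ → SupportedIn R C v → SupportedIn R′ C′ v
SupportedIn-mono v R≤R′ C≤C′ supp x ∉grid′ = supp x (∉grid′ ∘ InGrid-mono R≤R′ C≤C′ x)

when-SupportedIn : ∀ {R C} {P : Pred Cell _} (P? : Decidable P) (f : Cell → ℤ) →
                   (∀ x → P x → InGrid R C x) → SupportedIn R C (λ x → when (P? x) (f x))
when-SupportedIn P? f P⇒InGrid x ∉grid = when-no (P? x) (∉grid ∘ P⇒InGrid x)

inGrid? : ∀ R C x → Dec (InGrid R C x)
inGrid? R C (i , j) = ((1 ℕP.≤? i) ×-dec (i ℕP.≤? R)) ×-dec ((1 ℕP.≤? j) ×-dec (j ℕP.≤? C))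

∑-grid-extend : ∀ {R C R′ C′} (v : Cell → ℤ) → SupportedIn R C v → R ≤ R′ → C ≤ C′ →
                ∑ (grid R′ C′) v ≡ ∑ (grid R C) v
∑-grid-extend {R} {C} {R′} {C′} v vanish R≤R′ C≤C′ = begin
  ∑ (grid R′ C′) v                                            ≡⟨ ∑-grid R′ C′ v ⟩
  ∑ (upTo R′) (λ i → ∑ (upTo C′) (λ j → v (suc i , suc j)))   ≡⟨ ∑-applyUpTo-extend _ _ R≤R′ outside-rows ⟩
  ∑ (upTo R) (λ i → ∑ (upTo C′) (λ j → v (suc i , suc j)))    ≡⟨ ∑-cong (upTo R) inside-row ⟩
  ∑ (upTo R) (λ i → ∑ (upTo C) (λ j → v (suc i , suc j)))     ≡⟨ sym (∑-grid R C v) ⟩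
  ∑ (grid R C) v                                              ∎
  where
  open ≡-Reasoning
  outside-rows : ∀ i → R ≤ i → ∑ (upTo C′) (λ j → v (suc i , suc j)) ≡ 0ℤ
  outside-rows i R≤i = ∑-applyUpTo-vanishing _ C′ _ λ j →
    vanish (suc i , suc j) (λ ((_ , i<R) , _) → ℕP.<⇒≱ i<R R≤i)
  inside-row : ∀ i → ∑ (upTo C′) (λ j → v (suc i , suc j)) ≡ ∑ (upTo C) (λ j → v (suc i , suc j))
  inside-row i = ∑-applyUpTo-extend _ _ C≤C′ λ j C≤j →
    vanish (suc i , suc j) (λ (_ , (_ , j<C)) → ℕP.<⇒≱ j<C C≤j)

∑-grid-pointMass : ∀ {R C} c (d : ℤ) → InGrid R C c → ∑ (grid R C) (λ x → when (x ≟ᶜ c) d) ≡ d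
∑-grid-pointMass {R} {C} (suc t , suc u) d ((_ , t<R) , (_ , u<C)) = begin
  ∑ (grid R C) (λ x → when (x ≟ᶜ c) d)                                  ≡⟨ ∑-grid R C _ ⟩
  ∑ (upTo R) (λ i → ∑ (upTo C) (λ j → when ((suc i , suc j) ≟ᶜ c) d))   ≡⟨ ∑-applyUpTo-single _ _ t<R other-row ⟩
  ∑ (upTo C) (λ j → when ((suc t , suc j) ≟ᶜ c) d)                      ≡⟨ ∑-applyUpTo-single _ _ u<C other-column ⟩
  when (c ≟ᶜ c) d                                                       ≡⟨ when-yes (c ≟ᶜ c) refl ⟩
  d                                                                     ∎
  where
  open ≡-Reasoning
  c = (suc t , suc u)
  other-row : ∀ i → i ≢ t → ∑ (upTo C) (λ j → when ((suc i , suc j) ≟ᶜ c) d) ≡ 0ℤ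
  other-row i i≢t = ∑-applyUpTo-vanishing _ C _ λ j →
    when-no ((suc i , suc j) ≟ᶜ c) (i≢t ∘ ℕP.suc-injective ∘ cong proj₁)
  other-column : ∀ j → j ≢ u → when ((suc t , suc j) ≟ᶜ c) d ≡ 0ℤ
  other-column j j≢u = when-no ((suc t , suc j) ≟ᶜ c) (j≢u ∘ ℕP.suc-injective ∘ cong proj₂)

∑-filter-grid : ∀ {R₀ C₀ R C} {P : Pred Cell _} (P? : Decidable P) (f : Cell → ℤ) →
                (∀ x → P x → InGrid R₀ C₀ x) → R₀ ≤ R → C₀ ≤ C →
                ∑ (filter P? (grid R₀ C₀)) f ≡ ∑ (grid R C) (λ x → when (P? x) (f x))
∑-filter-grid {R₀} {C₀} P? f P⇒InGrid R₀≤R C₀≤C =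
  trans (∑-filter P? (grid R₀ C₀) f) (sym (∑-grid-extend _ (when-SupportedIn P? f P⇒InGrid) R₀≤R C₀≤C))

∑-grid-difference : ∀ {R C} (S : List Cell) → AllPairs _≢_ S → (w w′ : Cell → ℤ) →
                    SupportedIn R C w → SupportedIn R C w′ → (∀ x → All (x ≢_) S → w′ x ≡ w x) →
                    ∑ (grid R C) w′ ≡ ∑ (grid R C) w + ∑ S (λ c → w′ c - w c)
∑-grid-difference {R} {C} S distinct w w′ supp supp′ agree = begin
  ∑ (grid R C) w′                                                 ≡⟨ ∑-cong (grid R C) decompose ⟩
  ∑ (grid R C) (λ x → w x + ∑ S (λ c → when (x ≟ᶜ c) (δ c)))     ≡⟨ ∑-+ (grid R C) w _ ⟩
  ∑ (grid R C) w + ∑ (grid R C) (λ x → ∑ S (λ c → when (x ≟ᶜ c) (δ c)))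
                                                                  ≡⟨ cong (_+_ (∑ (grid R C) w)) (∑-comm (grid R C) S _) ⟩
  ∑ (grid R C) w + ∑ S (λ c → ∑ (grid R C) (λ x → when (x ≟ᶜ c) (δ c)))
                                                                  ≡⟨ cong (_+_ (∑ (grid R C) w)) (∑-cong S pointMass) ⟩
  ∑ (grid R C) w + ∑ S δ                                          ∎
  where
  open ≡-Reasoning
  δ : Cell → ℤ
  δ c = w′ c - w c
  decompose : ∀ x → w′ x ≡ w x + ∑ S (λ c → when (x ≟ᶜ c) (δ c))
  decompose x = pointwise-difference _≟ᶜ_ distinct w w′ x (agree x)
  pointMass : ∀ c → ∑ (grid R C) (λ x → when (x ≟ᶜ c) (δ c)) ≡ δ c
  pointMass c with inGrid? R C c
  ... | yes c∈grid = ∑-grid-pointMass c (δ c) c∈grid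
  ... | no  c∉grid = begin
    ∑ (grid R C) (λ x → when (x ≟ᶜ c) (δ c))   ≡⟨ ∑-zero (grid R C) (λ x → trans (cong (when (x ≟ᶜ c)) δc≡0) (when-zero (x ≟ᶜ c))) ⟩
    0ℤ                                          ≡⟨ sym δc≡0 ⟩
    δ c                                         ∎
    where
    δc≡0 : δ c ≡ 0ℤ
    δc≡0 = cong₂ _-_ (supp′ c c∉grid) (supp c c∉grid)

row-step : ∀ P i → row P (suc (suc i)) ≤ row P (suc i)
row-step P = go (parts P) (decr P)
  where
  go : ∀ xs → Linked ℕ._≥_ xs → ∀ i → rowL xs (suc (suc i)) ≤ rowL xs (suc i)
  go []           _          i       = z≤n
  go (x ∷ [])     _          zero    = z≤n
  go (x ∷ y ∷ ys) (x≥y ∷ _)  zero    = x≥y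
  go (x ∷ [])     _          (suc i) = z≤n
  go (x ∷ y ∷ ys) (_ ∷ decr) (suc i) = go (y ∷ ys) decr i

row-≤-first : ∀ P i → row P (suc i) ≤ row P 1
row-≤-first P zero    = ℕP.≤-refl
row-≤-first P (suc i) = ℕP.≤-trans (row-step P i) (row-≤-first P i)

row-beyond-length : ∀ P {i} → length (parts P) < i → row P i ≡ 0
row-beyond-length P = go (parts P)
  where
  go : ∀ xs {i} → length xs < i → rowL xs i ≡ 0
  go []       _                 = refl
  go (x ∷ xs) {suc (suc i)} (s≤s len<i) = go xs len<i

∈ᵖ-above : ∀ P {i j} → (suc i , j) ∈ᵖ P → 1 ≤ i → (i , j) ∈ᵖ P
∈ᵖ-above P {suc i} (_ , 1≤j , j≤row) _ = s≤s z≤n , 1≤j , ℕP.≤-trans j≤row (row-step P i)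

∈ᵖ-left : ∀ P {i j} → (i , suc j) ∈ᵖ P → 1 ≤ j → (i , j) ∈ᵖ P
∈ᵖ-left P (1≤i , _ , sj≤row) 1≤j = 1≤i , 1≤j , ℕP.≤-trans (ℕP.n≤1+n _) sj≤row

∈ᵖ⇒InGrid : ∀ P x → x ∈ᵖ P → InGrid (length (parts P)) (row P 1) x
∈ᵖ⇒InGrid P (suc i , j) (1≤i , 1≤j , j≤row) = (1≤i , i≤len) , (1≤j , ℕP.≤-trans j≤row (row-≤-first P i))
  where
  i≤len : suc i ≤ length (parts P)
  i≤len with suc i ℕP.≤? length (parts P)
  ... | yes i≤len = i≤len
  ... | no  i≰len = ⊥-elim (ℕP.<⇒≱ 1≤j (subst (j ≤_) (row-beyond-length P (ℕP.≰⇒> i≰len)) j≤row))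

IsAddable⇒InGrid : ∀ P x → IsAddable P x → InGrid (suc (length (parts P))) (suc (row P 1)) x
IsAddable⇒InGrid P (suc i , suc j) (_ , _ , _ , top-or-above , first-or-left) =
  (s≤s z≤n , i-bound top-or-above) , (s≤s z≤n , j-bound first-or-left)
  where
  i-bound : suc i ≡ 1 ⊎ (i , suc j) ∈ᵖ P → suc i ≤ suc (length (parts P))
  i-bound (inj₁ refl) = s≤s z≤n
  i-bound (inj₂ above∈P) = s≤s (proj₂ (proj₁ (∈ᵖ⇒InGrid P _ above∈P)))
  j-bound : suc j ≡ 1 ⊎ (suc i , j) ∈ᵖ P → suc j ≤ suc (row P 1)
  j-bound (inj₁ refl) = s≤s z≤n
  j-bound (inj₂ left∈P) = s≤s (proj₂ (proj₂ (∈ᵖ⇒InGrid P _ left∈P)))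

IsRemovable⇒InGrid : ∀ P x → IsRemovable P x → InGrid (suc (length (parts P))) (suc (row P 1)) x
IsRemovable⇒InGrid P x (x∈P , _) = InGrid-mono (ℕP.n≤1+n _) (ℕP.n≤1+n _) x (∈ᵖ⇒InGrid P x x∈P)

right below above left : Cell → Cell
right (i , j) = (i , suc j)
below (i , j) = (suc i , j)
above (i , j) = (ℕ.pred i , j)
left  (i , j) = (i , ℕ.pred j)

right≢self : ∀ x → right x ≢ x
right≢self _ = ℕP.1+n≢n ∘ cong proj₂

below≢self : ∀ x → below x ≢ x
below≢self _ = ℕP.1+n≢n ∘ cong proj₁

right≢below : ∀ x → right x ≢ below x
right≢below _ = ℕP.1+n≢n ∘ sym ∘ cong proj₁

below≡⇒≡above : ∀ x y → below x ≡ y → x ≡ above y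
below≡⇒≡above x _ refl = refl

right≡⇒≡left : ∀ x y → right x ≡ y → x ≡ left y
right≡⇒≡left x _ refl = refl

above≡⇒≡below : ∀ x i j → above x ≡ (suc i , j) → x ≡ below (suc i , j)
above≡⇒≡below (suc _ , _) i j refl = refl

left≡⇒≡right : ∀ x i j → left x ≡ (i , suc j) → x ≡ right (i , suc j)
left≡⇒≡right (_ , suc _) i j refl = refl

Agree : Partition → Partition → Cell → Set
Agree P Q x = x ∈ᵖ P ⇔ x ∈ᵖ Q

isAddable-transport : ∀ P Q x → Agree P Q x → Agree P Q (above x) → Agree P Q (left x) →
                      IsAddable P x → IsAddable Q x
isAddable-transport P Q (_ , _) here up lft (1≤i , 1≤j , x∉P , top-or-above , first-or-left) =
  1≤i , 1≤j , x∉P ∘ Equivalence.from here ,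
  Sum.map₂ (Equivalence.to up) top-or-above , Sum.map₂ (Equivalence.to lft) first-or-left

isRemovable-transport : ∀ P Q x → Agree P Q x → Agree P Q (below x) → Agree P Q (right x) →
                        IsRemovable P x → IsRemovable Q x
isRemovable-transport P Q (_ , _) here down rgt (x∈P , below∉P , right∉P) =
  Equivalence.to here x∈P , below∉P ∘ Equivalence.from down , right∉P ∘ Equivalence.from rgt

isAddable-⇔ : ∀ P Q x → Agree P Q x → Agree P Q (above x) → Agree P Q (left x) →
              IsAddable P x ⇔ IsAddable Q x
isAddable-⇔ P Q x here up lft = mk⇔ (isAddable-transport P Q x here up lft)
  (isAddable-transport Q P x (⇔.sym here) (⇔.sym up) (⇔.sym lft))

isRemovable-⇔ : ∀ P Q x → Agree P Q x → Agree P Q (below x) → Agree P Q (right x) →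
                IsRemovable P x ⇔ IsRemovable Q x
isRemovable-⇔ P Q x here down rgt = mk⇔ (isRemovable-transport P Q x here down rgt)
  (isRemovable-transport Q P x (⇔.sym here) (⇔.sym down) (⇔.sym rgt))

addableWeight removableWeight : Partition → (Cell → ℤ) → Cell → ℤ
addableWeight   P f x = when (isAddable? P x) (f x)
removableWeight P f x = when (isRemovable? P x) (f x)

module _ (P : Partition) (f : Cell → ℤ) {R C : ℕ}
         (len<R : length (parts P) < R) (row<C : row P 1 < C) where

  ∑-addableBoxes : ∑ (addableBoxes P) f ≡ ∑ (grid R C) (addableWeight P f)
  ∑-addableBoxes = ∑-filter-grid (isAddable? P) f (IsAddable⇒InGrid P) len<R row<C

  ∑-removableBoxes : ∑ (removableBoxes P) f ≡ ∑ (grid R C) (removableWeight P f)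
  ∑-removableBoxes = ∑-filter-grid (isRemovable? P) f (IsRemovable⇒InGrid P) len<R row<C

  addableWeight-supported : SupportedIn R C (addableWeight P f)
  addableWeight-supported =
    SupportedIn-mono _ len<R row<C (when-SupportedIn (isAddable? P) f (IsAddable⇒InGrid P))

  removableWeight-supported : SupportedIn R C (removableWeight P f)
  removableWeight-supported =
    SupportedIn-mono _ len<R row<C (when-SupportedIn (isRemovable? P) f (IsRemovable⇒InGrid P))

module CommonGrid (P Q : Partition) where

  R C : ℕ
  R = suc (length (parts P) ℕ.+ length (parts Q))
  C = suc (row P 1 ℕ.+ row Q 1)

  lenP<R : length (parts P) < R
  lenP<R = s≤s (ℕP.m≤m+n _ _)

  lenQ<R : length (parts Q) < R
  lenQ<R = s≤s (ℕP.m≤n+m _ _)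

  rowP<C : row P 1 < C
  rowP<C = s≤s (ℕP.m≤m+n _ _)

  rowQ<C : row Q 1 < C
  rowQ<C = s≤s (ℕP.m≤n+m _ _)

module _ (P Q : Partition) (agree : ∀ x → Agree P Q x) where
  open CommonGrid P Q

  ∑-addableBoxes-cong : ∀ f → ∑ (addableBoxes P) f ≡ ∑ (addableBoxes Q) f
  ∑-addableBoxes-cong f = begin
    ∑ (addableBoxes P) f                 ≡⟨ ∑-addableBoxes P f lenP<R rowP<C ⟩
    ∑ (grid R C) (addableWeight P f)     ≡⟨ ∑-cong (grid R C) (λ x → when-⇔ (agreeAddable x) (isAddable? P x) (isAddable? Q x)) ⟩
    ∑ (grid R C) (addableWeight Q f)     ≡⟨ sym (∑-addableBoxes Q f lenQ<R rowQ<C) ⟩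
    ∑ (addableBoxes Q) f                 ∎
    where
    open ≡-Reasoning
    agreeAddable : ∀ x → IsAddable P x ⇔ IsAddable Q x
    agreeAddable x = isAddable-⇔ P Q x (agree x) (agree (above x)) (agree (left x))

  ∑-removableBoxes-cong : ∀ f → ∑ (removableBoxes P) f ≡ ∑ (removableBoxes Q) f
  ∑-removableBoxes-cong f = begin
    ∑ (removableBoxes P) f               ≡⟨ ∑-removableBoxes P f lenP<R rowP<C ⟩
    ∑ (grid R C) (removableWeight P f)   ≡⟨ ∑-cong (grid R C) (λ x → when-⇔ (agreeRemovable x) (isRemovable? P x) (isRemovable? Q x)) ⟩
    ∑ (grid R C) (removableWeight Q f)   ≡⟨ sym (∑-removableBoxes Q f lenQ<R rowQ<C) ⟩
    ∑ (removableBoxes Q) f               ∎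
    where
    open ≡-Reasoning
    agreeRemovable : ∀ x → IsRemovable P x ⇔ IsRemovable Q x
    agreeRemovable x = isRemovable-⇔ P Q x (agree x) (agree (below x)) (agree (right x))

zero⊎positive : ∀ k → k ≡ 0 ⊎ 1 ≤ k
zero⊎positive zero    = inj₁ refl
zero⊎positive (suc k) = inj₂ (s≤s z≤n)

record IsAddBoxᵖ (Q P : Partition) (b : Cell) : Set where
  field
    fresh : ¬ (b ∈ᵖ P)
    boxes : ∀ c → c ∈ᵖ Q ⇔ (c ∈ᵖ P ⊎ c ≡ b)

IsAddBoxᵖ⇒∈ : ∀ {Q P b} → IsAddBoxᵖ Q P b → b ∈ᵖ Q
IsAddBoxᵖ⇒∈ {b = b} Q=P+b = Equivalence.from (IsAddBoxᵖ.boxes Q=P+b b) (inj₂ refl)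

-- b = (suc i , suc j); note that above b = right (i , j) and left b = below (i , j).
module AddBox {P Q : Partition} {i j : ℕ} (Q=P+b : IsAddBoxᵖ Q P (suc i , suc j)) where
  open CommonGrid P Q

  b : Cell
  b = (suc i , suc j)

  b∉P : ¬ (b ∈ᵖ P)
  b∉P = IsAddBoxᵖ.fresh Q=P+b

  P⊆Q : ∀ {x} → x ∈ᵖ P → x ∈ᵖ Q
  P⊆Q {x} x∈P = Equivalence.from (IsAddBoxᵖ.boxes Q=P+b x) (inj₁ x∈P)

  Q⊆P : ∀ {x} → x ∈ᵖ Q → x ≢ b → x ∈ᵖ P
  Q⊆P {x} x∈Q x≢b with Equivalence.to (IsAddBoxᵖ.boxes Q=P+b x) x∈Q
  ... | inj₁ x∈P = x∈P
  ... | inj₂ x≡b = ⊥-elim (x≢b x≡b)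

  b∈Q : b ∈ᵖ Q
  b∈Q = IsAddBoxᵖ⇒∈ Q=P+b

  agree : ∀ x → x ≢ b → Agree P Q x
  agree x x≢b = mk⇔ P⊆Q (λ x∈Q → Q⊆P x∈Q x≢b)

  right-b∉Q : ¬ (right b ∈ᵖ Q)
  right-b∉Q right∈Q = b∉P (∈ᵖ-left P (Q⊆P right∈Q (right≢self b)) (s≤s z≤n))

  below-b∉Q : ¬ (below b ∈ᵖ Q)
  below-b∉Q below∈Q = b∉P (∈ᵖ-above P (Q⊆P below∈Q (below≢self b)) (s≤s z≤n))

  above-b∈P : 1 ≤ i → above b ∈ᵖ P
  above-b∈P 1≤i = Q⊆P (∈ᵖ-above Q b∈Q 1≤i) (below≢self (above b) ∘ sym)

  left-b∈P : 1 ≤ j → left b ∈ᵖ P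
  left-b∈P 1≤j = Q⊆P (∈ᵖ-left Q b∈Q 1≤j) (right≢self (left b) ∘ sym)

  addable-b-P : IsAddable P b
  addable-b-P = s≤s z≤n , s≤s z≤n , b∉P ,
    Sum.map (cong suc) above-b∈P (zero⊎positive i) ,
    Sum.map (cong suc) left-b∈P (zero⊎positive j)

  ¬addable-b-Q : ¬ IsAddable Q b
  ¬addable-b-Q (_ , _ , b∉Q , _) = b∉Q b∈Q

  ¬addable-right-P : ¬ IsAddable P (right b)
  ¬addable-right-P (_ , _ , _ , _ , inj₂ b∈P) = b∉P b∈P

  ¬addable-below-P : ¬ IsAddable P (below b)
  ¬addable-below-P (_ , _ , _ , inj₂ b∈P , _) = b∉P b∈P

  ¬removable-b-P : ¬ IsRemovable P b
  ¬removable-b-P (b∈P , _) = b∉P b∈P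

  removable-b-Q : IsRemovable Q b
  removable-b-Q = b∈Q , below-b∉Q , right-b∉Q

  ¬removable-above-Q : ¬ IsRemovable Q (above b)
  ¬removable-above-Q (_ , b∉Q , _) = b∉Q b∈Q

  ¬removable-left-Q : ¬ IsRemovable Q (left b)
  ¬removable-left-Q (_ , _ , b∉Q) = b∉Q b∈Q

  addable-right : suc i ≡ 1 ⊎ (i , suc (suc j)) ∈ᵖ Q → IsAddable Q (right b)
  addable-right top-or-above = s≤s z≤n , s≤s z≤n , right-b∉Q , top-or-above , inj₂ b∈Q

  addable-below : suc j ≡ 1 ⊎ (suc (suc i) , j) ∈ᵖ Q → IsAddable Q (below b)
  addable-below first-or-left = s≤s z≤n , s≤s z≤n , below-b∉Q , inj₂ b∈Q , first-or-left

  addable-right⊎removable-above : IsAddable Q (right b) ⊎ IsRemovable P (above b)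
  addable-right⊎removable-above with zero⊎positive i
  ... | inj₁ i≡0 = inj₁ (addable-right (inj₁ (cong suc i≡0)))
  ... | inj₂ 1≤i with (i , suc (suc j)) ∈ᵖ? P
  ...   | yes diagonal∈P = inj₁ (addable-right (inj₂ (P⊆Q diagonal∈P)))
  ...   | no  diagonal∉P = inj₂ (above-b∈P 1≤i , b∉P , diagonal∉P)

  ¬addable-right×removable-above : ¬ (IsAddable Q (right b) × IsRemovable P (above b))
  ¬addable-right×removable-above ((_ , _ , _ , inj₁ si≡1 , _) , ((1≤i , _) , _)) =
    ℕP.<⇒≢ 1≤i (sym (ℕP.suc-injective si≡1))
  ¬addable-right×removable-above ((_ , _ , _ , inj₂ diagonal∈Q , _) , (_ , _ , diagonal∉P)) =
    diagonal∉P (Q⊆P diagonal∈Q (right≢below (above b)))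

  addable-below⊎removable-left : IsAddable Q (below b) ⊎ IsRemovable P (left b)
  addable-below⊎removable-left with zero⊎positive j
  ... | inj₁ j≡0 = inj₁ (addable-below (inj₁ (cong suc j≡0)))
  ... | inj₂ 1≤j with (suc (suc i) , j) ∈ᵖ? P
  ...   | yes diagonal∈P = inj₁ (addable-below (inj₂ (P⊆Q diagonal∈P)))
  ...   | no  diagonal∉P = inj₂ (left-b∈P 1≤j , diagonal∉P , b∉P)

  ¬addable-below×removable-left : ¬ (IsAddable Q (below b) × IsRemovable P (left b))
  ¬addable-below×removable-left ((_ , _ , _ , _ , inj₁ sj≡1) , ((_ , 1≤j , _) , _)) =
    ℕP.<⇒≢ 1≤j (sym (ℕP.suc-injective sj≡1))
  ¬addable-below×removable-left ((_ , _ , _ , _ , inj₂ diagonal∈Q) , (_ , diagonal∉P , _)) =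
    diagonal∉P (Q⊆P diagonal∈Q (right≢below (left b) ∘ sym))

  ∑-addable : ∀ f → ∑ (addableBoxes Q) f ≡
              ∑ (addableBoxes P) f + (- f b + (addableWeight Q f (right b) + addableWeight Q f (below b)))
  ∑-addable f = begin
    ∑ (addableBoxes Q) f                                                  ≡⟨ ∑-addableBoxes Q f lenQ<R rowQ<C ⟩
    ∑ (grid R C) (addableWeight Q f)                                      ≡⟨ ∑-grid-difference changed distinct _ _
                                                                               (addableWeight-supported P f lenP<R rowP<C)
                                                                               (addableWeight-supported Q f lenQ<R rowQ<C) unchanged ⟩
    ∑ (grid R C) (addableWeight P f) + ∑ changed (λ c → wQ c - wP c)     ≡⟨ cong₂ _+_ (sym (∑-addableBoxes P f lenP<R rowP<C)) changes ⟩
    ∑ (addableBoxes P) f + (- f b + (wQ (right b) + wQ (below b)))       ∎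
    where
    open ≡-Reasoning
    wP wQ : Cell → ℤ
    wP = addableWeight P f
    wQ = addableWeight Q f
    changed : List Cell
    changed = b ∷ right b ∷ below b ∷ []
    distinct : AllPairs _≢_ changed
    distinct = ((right≢self b ∘ sym) ∷ (below≢self b ∘ sym) ∷ []) ∷ (right≢below b ∷ []) ∷ [] ∷ []
    unchanged : ∀ x → All (x ≢_) changed → wQ x ≡ wP x
    unchanged x (x≢b ∷ x≢right ∷ x≢below ∷ []) = sym (when-⇔ addable⇔ (isAddable? P x) (isAddable? Q x))
      where
      addable⇔ : IsAddable P x ⇔ IsAddable Q x
      addable⇔ = isAddable-⇔ P Q x (agree x x≢b)
        (agree (above x) (x≢below ∘ above≡⇒≡below x i (suc j)))
        (agree (left x) (x≢right ∘ left≡⇒≡right x (suc i) j))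
    tidy : ∀ {qb pb pr pd} x u v → qb ≡ 0ℤ → pb ≡ x → pr ≡ 0ℤ → pd ≡ 0ℤ →
           (qb - pb) + ((u - pr) + ((v - pd) + 0ℤ)) ≡ - x + (u + v)
    tidy x u v refl refl refl refl = normalise x u v
      where
      normalise : ∀ x u v → (0ℤ - x) + ((u - 0ℤ) + ((v - 0ℤ) + 0ℤ)) ≡ - x + (u + v)
      normalise = solve-∀
    changes : ∑ changed (λ c → wQ c - wP c) ≡ - f b + (wQ (right b) + wQ (below b))
    changes = tidy (f b) (wQ (right b)) (wQ (below b))
      (when-no (isAddable? Q b) ¬addable-b-Q) (when-yes (isAddable? P b) addable-b-P)
      (when-no (isAddable? P (right b)) ¬addable-right-P) (when-no (isAddable? P (below b)) ¬addable-below-P)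

  ∑-removable : ∀ g → ∑ (removableBoxes Q) g ≡
                ∑ (removableBoxes P) g + (g b - (removableWeight P g (above b) + removableWeight P g (left b)))
  ∑-removable g = begin
    ∑ (removableBoxes Q) g                                                ≡⟨ ∑-removableBoxes Q g lenQ<R rowQ<C ⟩
    ∑ (grid R C) (removableWeight Q g)                                    ≡⟨ ∑-grid-difference changed distinct _ _
                                                                               (removableWeight-supported P g lenP<R rowP<C)
                                                                               (removableWeight-supported Q g lenQ<R rowQ<C) unchanged ⟩
    ∑ (grid R C) (removableWeight P g) + ∑ changed (λ c → wQ c - wP c)   ≡⟨ cong₂ _+_ (sym (∑-removableBoxes P g lenP<R rowP<C)) changes ⟩
    ∑ (removableBoxes P) g + (g b - (wP (above b) + wP (left b)))         ∎
    where
    open ≡-Reasoning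
    wP wQ : Cell → ℤ
    wP = removableWeight P g
    wQ = removableWeight Q g
    changed : List Cell
    changed = b ∷ above b ∷ left b ∷ []
    distinct : AllPairs _≢_ changed
    distinct = (below≢self (above b) ∷ right≢self (left b) ∷ []) ∷ (right≢below (i , j) ∷ []) ∷ [] ∷ []
    unchanged : ∀ x → All (x ≢_) changed → wQ x ≡ wP x
    unchanged x (x≢b ∷ x≢above ∷ x≢left ∷ []) = sym (when-⇔ removable⇔ (isRemovable? P x) (isRemovable? Q x))
      where
      removable⇔ : IsRemovable P x ⇔ IsRemovable Q x
      removable⇔ = isRemovable-⇔ P Q x (agree x x≢b)
        (agree (below x) (x≢above ∘ below≡⇒≡above x b))
        (agree (right x) (x≢left ∘ right≡⇒≡left x b))
    tidy : ∀ {qb pb qa qd} x u v → qb ≡ x → pb ≡ 0ℤ → qa ≡ 0ℤ → qd ≡ 0ℤ →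
           (qb - pb) + ((qa - u) + ((qd - v) + 0ℤ)) ≡ x - (u + v)
    tidy x u v refl refl refl refl = normalise x u v
      where
      normalise : ∀ x u v → (x - 0ℤ) + ((0ℤ - u) + ((0ℤ - v) + 0ℤ)) ≡ x - (u + v)
      normalise = solve-∀
    changes : ∑ changed (λ c → wQ c - wP c) ≡ g b - (wP (above b) + wP (left b))
    changes = tidy (g b) (wP (above b)) (wP (left b))
      (when-yes (isRemovable? Q b) removable-b-Q) (when-no (isRemovable? P b) ¬removable-b-P)
      (when-no (isRemovable? Q (above b)) ¬removable-above-Q) (when-no (isRemovable? Q (left b)) ¬removable-left-Q)

  ∑-addBox : ∀ f g → (∀ c → g c ≡ - f (below (right c))) →
             ∑ (addableBoxes Q) f + ∑ (removableBoxes Q) g ≡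
             (∑ (addableBoxes P) f + ∑ (removableBoxes P) g) + ((- f b + g b) + (f (right b) + f (below b)))
  ∑-addBox f g g≡-f∘diagonal = begin
    ∑ (addableBoxes Q) f + ∑ (removableBoxes Q) g
      ≡⟨ cong₂ _+_ (∑-addable f) (∑-removable g) ⟩
    (∑A + (- f b + (X₁ + X₂))) + (∑R + (g b - (removableWeight P g (above b) + removableWeight P g (left b))))
      ≡⟨ cong₂ (λ u v → (∑A + (- f b + (X₁ + X₂))) + (∑R + (g b - (u + v)))) (diagonal (above b)) (diagonal (left b)) ⟩
    (∑A + (- f b + (X₁ + X₂))) + (∑R + (g b - (- Y₁ + - Y₂)))
      ≡⟨ regroup ∑A ∑R (f b) (g b) X₁ X₂ Y₁ Y₂ ⟩
    (∑A + ∑R) + ((- f b + g b) + ((X₁ + Y₁) + (X₂ + Y₂)))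
      ≡⟨ cong₂ (λ u v → (∑A + ∑R) + ((- f b + g b) + (u + v)))
           (when-exclusive (isAddable? Q (right b)) (isRemovable? P (above b))
                           addable-right⊎removable-above ¬addable-right×removable-above)
           (when-exclusive (isAddable? Q (below b)) (isRemovable? P (left b))
                           addable-below⊎removable-left ¬addable-below×removable-left) ⟩
    (∑A + ∑R) + ((- f b + g b) + (f (right b) + f (below b)))
      ∎
    where
    open ≡-Reasoning
    ∑A ∑R X₁ X₂ Y₁ Y₂ : ℤ
    ∑A = ∑ (addableBoxes P) f
    ∑R = ∑ (removableBoxes P) g
    X₁ = addableWeight Q f (right b)
    X₂ = addableWeight Q f (below b)
    Y₁ = when (isRemovable? P (above b)) (f (right b))
    Y₂ = when (isRemovable? P (left b)) (f (below b))
    diagonal : ∀ c → removableWeight P g c ≡ - when (isRemovable? P c) (f (below (right c)))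
    diagonal c = trans (cong (when (isRemovable? P c)) (g≡-f∘diagonal c)) (when-neg (isRemovable? P c) _)
    regroup : ∀ A R x r u v u′ v′ →
              (A + (- x + (u + v))) + (R + (r - (- u′ + - v′))) ≡ (A + R) + ((- x + r) + ((u + u′) + (v + v′)))
    regroup = solve-∀

module _ (n : ℕ) {{_ : NonZero n}} where

  private
    no-positive-multiple : ∀ {r r′} d → r < n → + r ≢ + r′ + + suc d * + n
    no-positive-multiple {r} {r′} d r<n e = ℕP.<⇒≱ r<n (begin
      n                  ≤⟨ ℕP.m≤m+n n (d ℕ.* n) ⟩
      suc d ℕ.* n        ≤⟨ ℕP.m≤n+m _ r′ ⟩
      r′ ℕ.+ suc d ℕ.* n ≡⟨ ℤP.+-injective (trans (cong (_+_ (+ r′)) (ℤP.pos-* (suc d) n)) (sym e)) ⟩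
      r                  ∎)
      where open ℕP.≤-Reasoning

  remainder-unique : ∀ {r r′} q → r < n → r′ < n → + r ≡ + r′ + q * + n → r ≡ r′
  remainder-unique {r′ = r′} (+ zero)  _   _    e = ℤP.+-injective (trans e (ℤP.+-identityʳ (+ r′)))
  remainder-unique           (+ suc d) r<n _    e = ⊥-elim (no-positive-multiple d r<n e)
  remainder-unique {r} {r′}  -[1+ d ]  _   r′<n e = ⊥-elim (no-positive-multiple d r′<n (flip (+ r) (+ r′) (+ suc d) (+ n) e))
    where
    flip : ∀ x y a b → x ≡ y + (- a) * b → y ≡ x + a * b
    flip x y a b refl = cancel y a b
      where
      cancel : ∀ y a b → y ≡ (y + (- a) * b) + a * b
      cancel = solve-∀

  %ℕ-+-multiple : ∀ z q → (z + q * + n) %ℕ n ≡ z %ℕ n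
  %ℕ-+-multiple z q = remainder-unique ((z /ℕ n + q) - (z + q * + n) /ℕ n) (n%ℕd<d (z + q * + n) n) (n%ℕd<d z n) (begin
    + r                              ≡⟨ add-sub (+ r) (Q * + n) ⟩
    (+ r + Q * + n) - Q * + n        ≡⟨ cong (_- Q * + n) (sym (a≡a%ℕn+[a/ℕn]*n (z + q * + n) n)) ⟩
    (z + q * + n) - Q * + n          ≡⟨ cong (λ t → (t + q * + n) - Q * + n) (a≡a%ℕn+[a/ℕn]*n z n) ⟩
    ((+ r′ + P * + n) + q * + n) - Q * + n ≡⟨ regroup (+ r′) P q Q (+ n) ⟩
    + r′ + ((P + q) - Q) * + n       ∎)
    where
    open ≡-Reasoning
    r r′ : ℕ
    r  = (z + q * + n) %ℕ n
    r′ = z %ℕ n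
    P Q : ℤ
    P = z /ℕ n
    Q = (z + q * + n) /ℕ n
    add-sub : ∀ x y → x ≡ (x + y) - y
    add-sub = solve-∀
    regroup : ∀ x P q Q m → ((x + P * m) + q * m) - Q * m ≡ x + ((P + q) - Q) * m
    regroup = solve-∀

  res-+ : ∀ z e → res n (z + e) ≡ res n (+ toℕ (res n z) + e)
  res-+ z e = FinP.fromℕ<-cong _ _ (begin
    (z + e) %ℕ n                             ≡⟨ cong (λ t → (t + e) %ℕ n) (a≡a%ℕn+[a/ℕn]*n z n) ⟩
    ((+ (z %ℕ n) + (z /ℕ n) * + n) + e) %ℕ n ≡⟨ cong (_%ℕ n) (swap-last (+ (z %ℕ n)) ((z /ℕ n) * + n) e) ⟩
    ((+ (z %ℕ n) + e) + (z /ℕ n) * + n) %ℕ n ≡⟨ %ℕ-+-multiple (+ (z %ℕ n) + e) (z /ℕ n) ⟩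
    (+ (z %ℕ n) + e) %ℕ n                    ≡⟨ cong (λ t → (+ t + e) %ℕ n) (sym (FinP.toℕ-fromℕ< (n%ℕd<d z n))) ⟩
    (+ toℕ (res n z) + e) %ℕ n               ∎) (n%ℕd<d (z + e) n) (n%ℕd<d (+ toℕ (res n z) + e) n)
    where
    open ≡-Reasoning
    swap-last : ∀ a b c → (a + b) + c ≡ (a + c) + b
    swap-last = solve-∀

module _ (n : ℕ) {{_ : NonZero n}} {ℓ} (p : Fin ℓ → Fin n) where

  colour-right : ∀ k i j → colour n p (k , i , suc j) ≡ sucᶻ n (colour n p (k , i , j))
  colour-right k i j = trans (cong (res n) (shift (+ toℕ (p k) - + i) (+ j))) (res-+ n ((+ toℕ (p k) - + i) + + j) 1ℤ)
    where
    shift : ∀ z y → z + (1ℤ + y) ≡ (z + y) + 1ℤ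
    shift = solve-∀

  colour-below : ∀ k i j → colour n p (k , suc i , j) ≡ predᶻ n (colour n p (k , i , j))
  colour-below k i j = trans (cong (res n) (shift (+ toℕ (p k)) (+ i) (+ j))) (res-+ n ((+ toℕ (p k) - + i) + + j) (- 1ℤ))
    where
    shift : ∀ q x y → (q - (1ℤ + x)) + y ≡ ((q - x) + y) + - 1ℤ
    shift = solve-∀

  colour-diagonal : ∀ k i j → colour n p (k , suc i , suc j) ≡ colour n p (k , i , j)
  colour-diagonal k i j = cong (res n) (shift (+ toℕ (p k)) (+ i) (+ j))
    where
    shift : ∀ q x y → (q - (1ℤ + x)) + (1ℤ + y) ≡ (q - x) + y
    shift = solve-∀

module _ {ℓ} (s : SlopeDatum ℓ) where

  h-right : ∀ k i j → h s (k , i , suc j) ≡ h s (k , i , j) + + ξΩ̄ s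
  h-right k i j = cong +_ (shift (ξ s k) (ξΩ s) (ξΩ̄ s) i j)
    where
    shift : ∀ a b c i j → a ℕ.+ b ℕ.* i ℕ.+ c ℕ.* suc j ≡ (a ℕ.+ b ℕ.* i ℕ.+ c ℕ.* j) ℕ.+ c
    shift = ℕSolver.solve-∀

  h-below : ∀ k i j → h s (k , suc i , j) ≡ h s (k , i , j) + + ξΩ s
  h-below k i j = cong +_ (shift (ξ s k) (ξΩ s) (ξΩ̄ s) i j)
    where
    shift : ∀ a b c i j → a ℕ.+ b ℕ.* suc i ℕ.+ c ℕ.* j ≡ (a ℕ.+ b ℕ.* i ℕ.+ c ℕ.* j) ℕ.+ b
    shift = ℕSolver.solve-∀

  h-diagonal : ∀ k i j → h s (k , suc i , suc j) ≡ h s (k , i , j) + + Kof s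
  h-diagonal k i j = cong +_ (shift (ξ s k) (ξΩ s) (ξΩ̄ s) i j)
    where
    shift : ∀ a b c i j → a ℕ.+ b ℕ.* suc i ℕ.+ c ℕ.* suc j ≡ (a ℕ.+ b ℕ.* i ℕ.+ c ℕ.* j) ℕ.+ (b ℕ.+ c)
    shift = ℕSolver.solve-∀

module Evaluation (n : ℕ) {{_ : NonZero n}} {ℓ} (p : Fin ℓ → Fin n) (s : SlopeDatum ℓ) (a : Fin n) (m : ℤ) where

  prodL-eval : ∀ (F : A → Monomial n) xs → prodL n F xs a m ≡ ∑ xs (λ x → F x a m)
  prodL-eval F []       = refl
  prodL-eval F (x ∷ xs) = cong (_+_ (F x a m)) (prodL-eval F xs)

  addedY removedY : Fin ℓ → Cell → Monomial n
  addedY   k (i , j) = Y n (colour n p (k , i , j)) (h s (k , i , j))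
  removedY k (i , j) = inv n (Y n (colour n p (k , i , j)) (h s (k , i , j) + + Kof s))

  addedTerm removedTerm : Fin ℓ → Cell → ℤ
  addedTerm   k x = addedY k x a m
  removedTerm k x = removedY k x a m

  weight : Fin ℓ → Partition → ℤ
  weight k P = ∑ (addableBoxes P) (addedTerm k) + ∑ (removableBoxes P) (removedTerm k)

  Ψ-eval : ∀ X → Ψ n p s X a m ≡ ∑ (allFin ℓ) (λ k → weight k (X k))
  Ψ-eval X = trans (prodL-eval component (allFin ℓ)) (∑-cong (allFin ℓ) λ k →
    cong₂ _+_ (prodL-eval (addedY k) (addableBoxes (X k))) (prodL-eval (removedY k) (removableBoxes (X k))))
    where
    component : Fin ℓ → Monomial n
    component k = _·_ n (prodL n (addedY k) (addableBoxes (X k))) (prodL n (removedY k) (removableBoxes (X k)))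

  -- The boxes (i , j) and (i + 1 , j + 1) have the same colour, and their heights differ by K.
  removedTerm-diagonal : ∀ k x → removedTerm k x ≡ - addedTerm k (below (right x))
  removedTerm-diagonal k (i , j) = cong -_ (sym (cong₂ (λ c t → Y n c t a m) (colour-diagonal n p k i j) (h-diagonal s k i j)))

  addedTerm-right : ∀ k i j → addedTerm k (right (i , j)) ≡ Y n (sucᶻ n (colour n p (k , i , j))) (h s (k , i , j) + + ξΩ̄ s) a m
  addedTerm-right k i j = cong₂ (λ c t → Y n c t a m) (colour-right n p k i j) (h-right s k i j)

  addedTerm-below : ∀ k i j → addedTerm k (below (i , j)) ≡ Y n (predᶻ n (colour n p (k , i , j))) (h s (k , i , j) + + ξΩ s) a m
  addedTerm-below k i j = cong₂ (λ c t → Y n c t a m) (colour-below n p k i j) (h-below s k i j)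

  weight-addBox : ∀ k {P Q} x → IsAddBoxᵖ Q P x →
                  weight k Q ≡ - Amon n s (colour n p (k , x)) (h s (k , x)) a m + weight k P
  weight-addBox k (zero  , _)     Q=P+b = ⊥-elim (ℕP.n≮0 (proj₁ (IsAddBoxᵖ⇒∈ Q=P+b)))
  weight-addBox k (suc _ , zero)  Q=P+b = ⊥-elim (ℕP.n≮0 (proj₁ (proj₂ (IsAddBoxᵖ⇒∈ Q=P+b))))
  weight-addBox k {P} {Q} (suc i , suc j) Q=P+b = begin
    weight k Q
      ≡⟨ ∑-addBox (addedTerm k) (removedTerm k) (removedTerm-diagonal k) ⟩
    weight k P + ((- addedTerm k b + removedTerm k b) + (addedTerm k (right b) + addedTerm k (below b)))
      ≡⟨ cong₂ (λ u v → weight k P + ((- addedTerm k b + removedTerm k b) + (u + v)))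
               (addedTerm-right k (suc i) (suc j)) (addedTerm-below k (suc i) (suc j)) ⟩
    weight k P + ((- addedTerm k b + removedTerm k b) + (Y⁺ + Y⁻))
      ≡⟨ negate (weight k P) (addedTerm k b) Yᴷ Y⁺ Y⁻ ⟩
    - Amon n s (colour n p (k , b)) (h s (k , b)) a m + weight k P
      ∎
    where
    open ≡-Reasoning
    open AddBox Q=P+b
    Yᴷ Y⁺ Y⁻ : ℤ
    Yᴷ = Y n (colour n p (k , b)) (h s (k , b) + + Kof s) a m
    Y⁺ = Y n (sucᶻ n (colour n p (k , b))) (h s (k , b) + + ξΩ̄ s) a m
    Y⁻ = Y n (predᶻ n (colour n p (k , b))) (h s (k , b) + + ξΩ s) a m
    negate : ∀ w y y′ u v → w + ((- y + - y′) + (u + v)) ≡ - (((y + y′) + - u) + - v) + w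
    negate = solve-∀

module _ {ℓ} (la mu : MultiPartition ℓ) (k₀ : Fin ℓ) (b : Cell) (mu=la+b : IsAddBox mu la (k₀ , b)) where

  IsAddBox⇒IsAddBoxᵖ : IsAddBoxᵖ (mu k₀) (la k₀) b
  IsAddBox⇒IsAddBoxᵖ = record
    { fresh = proj₁ mu=la+b
    ; boxes = λ c → mk⇔ (Sum.map₂ (cong proj₂) ∘ Equivalence.to (proj₂ mu=la+b (k₀ , c)))
                        (Equivalence.from (proj₂ mu=la+b (k₀ , c)) ∘ Sum.map₂ (cong (k₀ ,_)))
    }

  IsAddBox⇒Agree : ∀ {k} → k ≢ k₀ → ∀ c → Agree (la k) (mu k) c
  IsAddBox⇒Agree {k} k≢k₀ c = mk⇔ (λ c∈la → Equivalence.from (proj₂ mu=la+b (k , c)) (inj₁ c∈la)) from-mu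
    where
    from-mu : c ∈ᵖ mu k → c ∈ᵖ la k
    from-mu c∈mu with Equivalence.to (proj₂ mu=la+b (k , c)) c∈mu
    ... | inj₁ c∈la = c∈la
    ... | inj₂ kc≡k₀b = ⊥-elim (k≢k₀ (cong proj₁ kc≡k₀b))

lemma8p4 : (n : ℕ) {{_ : NonZero n}} → 2 ≤ n → (ℓ : ℕ) → 1 ≤ ℓ
    → (p : Fin ℓ → Fin n) (s : SlopeDatum ℓ) → Integral s
    → (la mu : MultiPartition ℓ) (b : Box ℓ) (i : Fin n)
    → IsAddBox mu la b → colour n p b ≡ i
    → _≈_ n (Ψ n p s mu) (_·_ n (inv n (Amon n s i (h s b))) (Ψ n p s la))
lemma8p4 n _ ℓ _ p s _ la mu (k₀ , x) _ mu=la+b refl a m = begin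
  Ψ n p s mu a m                                       ≡⟨ Ψ-eval mu ⟩
  ∑ (allFin ℓ) (λ k → weight k (mu k))                ≡⟨ ∑-allFin-update (λ k → weight k (la k)) (λ k → weight k (mu k)) k₀ (- Aᵇ) unchanged changed ⟩
  - Aᵇ + ∑ (allFin ℓ) (λ k → weight k (la k))         ≡⟨ cong (_+_ (- Aᵇ)) (sym (Ψ-eval la)) ⟩
  - Aᵇ + Ψ n p s la a m                                ∎
  where
  open ≡-Reasoning
  open Evaluation n p s a m
  Aᵇ : ℤ
  Aᵇ = Amon n s (colour n p (k₀ , x)) (h s (k₀ , x)) a m
  unchanged : ∀ k → k ≢ k₀ → weight k (mu k) ≡ weight k (la k)
  unchanged k k≢k₀ = sym (cong₂ _+_ (∑-addableBoxes-cong (la k) (mu k) agree _) (∑-removableBoxes-cong (la k) (mu k) agree _))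
    where
    agree : ∀ c → Agree (la k) (mu k) c
    agree = IsAddBox⇒Agree la mu k₀ x mu=la+b k≢k₀
  changed : weight k₀ (mu k₀) ≡ - Aᵇ + weight k₀ (la k₀)
  changed = weight-addBox k₀ x (IsAddBox⇒IsAddBoxᵖ la mu k₀ x mu=la+b)
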